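{- Let $\mathcal{C}(\widetilde{D}_7)$ be the point-line incidence structure with points $0,\dots,7$ and lines $\{0,2\},\{1,2\},\{2,3\},\{3,4\},\{4,5\},\{5,6\},\{5,7\}$. Consider the two labelings by elements of $\overline{\mathcal{P}}_2$: (a) $0\mapsto ZI,1\mapsto XI,2\mapsto YI,3\mapsto II,4\mapsto II,5\mapsto IY,6\mapsto IZ,7\mapsto IX$; (b) $0\mapsto ZI,1\mapsto XI,2\mapsto II,3\mapsto YI,4\mapsto IY,5\mapsto II,6\mapsto IZ,7\mapsto IX$; each geometric hyperplane being labeled by the product of the labels of its points. Then (a) and (b) induce the same labeling of the $15$ hyperplanes containing $\{2,3,4,5\}$; it is a bijection onto the $15$ non-identity elements of $\overline{\mathcal{P}}_2$ such that the labels on each three-point Veldkamp line among them multiply to $II$, the pairwise commuting such triples form a copy of $W(3,2)$, and removing the six elements $IX,IY,IZ,XI,YI,ZI$ leaves nine elements forming a Mermin–Peres magic square ($3\times3$ grid of pairwise commuting triples lying on three-point Veldkamp lines).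
   Context: A geometric hyperplane is a proper subset $H$ of the point set such that every line is either contained in $H$ or meets $H$ in exactly one point. A three-point Veldkamp line is a set $\{H_1,H_2,H_3\}$ of three distinct geometric hyperplanes with $H_3$ the complement of $H_1\triangle H_2$. $\overline{\mathcal{P}}_N$ is the $N$-qubit Pauli group modulo its center $\{\pm I^{\otimes N},\pm iI^{\otimes N}\}$, elements written as words $A_1\cdots A_N$ ($A_k\in\{I,X,Y,Z\}$) and multiplied ignoring phases; commutation is that of representing matrices. $W(3,2)$ is the symplectic polar space of rank $2$ over $\mathrm{GF}(2)$. A $3\times3$ grid has $9$ points and $6$ lines of size three in two parallel classes of three, each point on one line of each class. -}

module Defs where

open import Data.Bool using (Bool; true; false; _xor_; not; if_then_else_; _∧_)
open import Data.Nat using (ℕ)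
open import Data.Fin using (Fin)
open import Data.Fin.Patterns
open import Data.Fin.Subset using (Subset; _∈_; _∉_; ∁)
open import Data.List using (List; []; _∷_; length; filter)
open import Data.List.Relation.Unary.All using (All)
open import Data.Vec using (Vec; []; _∷_; zipWith; foldr; lookup)
open import Data.Product using (_×_; _,_; ∃; Σ)
open import Data.Sum using (_⊎_)
open import Relation.Binary.PropositionalEquality using (_≡_; _≢_)
open import Relation.Nullary using (¬_)
open import Data.Fin.Subset.Properties using (_∈?_)

record Geometry : Set where
  field
    nPts  : ℕ
    lines : List (List (Fin nPts))
open Geometry public

countIn : ∀ {n} → List (Fin n) → Subset n → ℕ
countIn L H = length (filter (λ p → p ∈? H) L)

IsHyperplane : (G : Geometry) → Subset (nPts G) → Set
IsHyperplane G H =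
  (∃ λ p → p ∉ H) ×
  All (λ L → All (λ p → p ∈ H) L ⊎ countIn L H ≡ 1) (lines G)

_△_ : ∀ {n} → Subset n → Subset n → Subset n
A △ B = zipWith _xor_ A B

IsVeldkampLine : (G : Geometry) → (H₁ H₂ H₃ : Subset (nPts G)) → Set
IsVeldkampLine G H₁ H₂ H₃ =
  IsHyperplane G H₁ × IsHyperplane G H₂ × IsHyperplane G H₃ ×
  H₁ ≢ H₂ × H₁ ≢ H₃ × H₂ ≢ H₃ × H₃ ≡ ∁ (H₁ △ H₂)

CD7 : Geometry
CD7 = record
  { nPts  = 8
  ; lines = (0F ∷ 2F ∷ []) ∷ (1F ∷ 2F ∷ []) ∷ (2F ∷ 3F ∷ []) ∷ (3F ∷ 4F ∷ [])
          ∷ (4F ∷ 5F ∷ []) ∷ (5F ∷ 6F ∷ []) ∷ (5F ∷ 7F ∷ []) ∷ []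
  }

data Pauli : Set where
  I X Y Z : Pauli

-- single-qubit product ignoring phases
_·₁_ : Pauli → Pauli → Pauli
I ·₁ b = b
a ·₁ I = a
X ·₁ X = I
X ·₁ Y = Z
X ·₁ Z = Y
Y ·₁ X = Z
Y ·₁ Y = I
Y ·₁ Z = X
Z ·₁ X = Y
Z ·₁ Y = X
Z ·₁ Z = I

anti₁ : Pauli → Pauli → Bool
anti₁ I _ = false
anti₁ _ I = false
anti₁ X X = false
anti₁ Y Y = false
anti₁ Z Z = false
anti₁ _ _ = true

Pauli2 : Set
Pauli2 = Pauli × Pauli

II : Pauli2
II = I , I

_·_ : Pauli2 → Pauli2 → Pauli2
(a₁ , a₂) · (b₁ , b₂) = (a₁ ·₁ b₁) , (a₂ ·₁ b₂)
infixl 7 _·_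

-- two-qubit words commute iff they anticommute in an even number of positions
Commute : Pauli2 → Pauli2 → Set
Commute (a₁ , a₂) (b₁ , b₂) = (anti₁ a₁ b₁ xor anti₁ a₂ b₂) ≡ false

PairwiseCommute : Pauli2 → Pauli2 → Pauli2 → Set
PairwiseCommute P Q R = Commute P Q × Commute P R × Commute Q R

Labeling : Set
Labeling = Vec Pauli2 8

labelingA : Labeling
labelingA = (Z , I) ∷ (X , I) ∷ (Y , I) ∷ (I , I) ∷ (I , I) ∷ (I , Y) ∷ (I , Z) ∷ (I , X) ∷ []

labelingB : Labeling
labelingB = (Z , I) ∷ (X , I) ∷ (I , I) ∷ (Y , I) ∷ (I , Y) ∷ (I , I) ∷ (I , Z) ∷ (I , X) ∷ []

labelOf : ∀ {n} → Vec Pauli2 n → Subset n → Pauli2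
labelOf ℓ H = foldr _ _·_ II (zipWith (λ b P → if b then P else II) H ℓ)

InS : Subset 8 → Set
InS H = IsHyperplane CD7 H × 2F ∈ H × 3F ∈ H × 4F ∈ H × 5F ∈ H

CommVeldkampTriple : Labeling → Pauli2 → Pauli2 → Pauli2 → Set
CommVeldkampTriple ℓ P Q R =
  PairwiseCommute P Q R ×
  ∃ λ H₁ → ∃ λ H₂ → ∃ λ H₃ → InS H₁ × InS H₂ × InS H₃ ×
    IsVeldkampLine CD7 H₁ H₂ H₃ ×
    labelOf ℓ H₁ ≡ P × labelOf ℓ H₂ ≡ Q × labelOf ℓ H₃ ≡ R

-- The symplectic polar space W(3,2): points = nonzero vectors of GF(2)^4,
-- lines = totally isotropic 2-subspaces {u, v, u+v}, ω(u,v) = 0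

V4 : Set
V4 = Vec Bool 4

zero4 : V4
zero4 = false ∷ false ∷ false ∷ false ∷ []

_+4_ : V4 → V4 → V4
u +4 v = zipWith _xor_ u v

ω : V4 → V4 → Bool
ω (u₁ ∷ u₂ ∷ u₃ ∷ u₄ ∷ []) (v₁ ∷ v₂ ∷ v₃ ∷ v₄ ∷ []) =
  ((u₁ ∧ v₂) xor (u₂ ∧ v₁)) xor ((u₃ ∧ v₄) xor (u₄ ∧ v₃))

W32Point : V4 → Set
W32Point u = u ≢ zero4

W32Line : V4 → V4 → V4 → Set
W32Line u v w = W32Point u × W32Point v × u ≢ v × w ≡ u +4 v × ω u v ≡ false

SingleQubit : Pauli2 → Set
SingleQubit P = P ≡ (I , X) ⊎ P ≡ (I , Y) ⊎ P ≡ (I , Z) ⊎ P ≡ (X , I) ⊎ P ≡ (Y , I) ⊎ P ≡ (Z , I)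

Nine : Pauli2 → Set
Nine P = P ≢ II × ¬ SingleQubit P

-- A set containing {2,3,4,5} meets every line of C(D̃₇), so it is a
-- hyperplane iff it is proper, and it is determined by which of the end points
-- 0, 1, 6, 7 it omits.  Read these omissions as the bits z₁, x₁, z₂, x₂ of a
-- vector u ∈ GF(2)⁴ ∖ {0}.  The labels of all eight points multiply to II and
-- both labelings put YY on {2,3,4,5}; so in either labeling a hyperplane is
-- labelled by the product of the points it omits, which is the Pauli operator
-- with symplectic coordinates u.  The third hyperplane ∁ (H₁ △ H₂) of a
-- Veldkamp line has coordinates u₁ + u₂, and two Pauli operators commute iff
-- their coordinates are ω-orthogonal; hence the labelled hyperplanes form
-- W(3,2).  The magic square is then a finite check among the nine operators
-- with no identity factor.
module Submission where

open import Data.Bool using (Bool; true; false; _xor_; not)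
import Data.Bool as Bool
open import Data.Bool.Properties using (not-involutive; xor-comm)
open import Data.Fin using (Fin)
import Data.Fin as Fin
open import Data.Fin.Patterns using (0F; 1F; 2F; 3F; 4F; 5F)
open import Data.Fin.Properties using (any?; all?)
open import Data.Fin.Subset using (Subset; _∈_; ∁)
open import Data.Fin.Subset.Properties using (_∈?_; ∈⊤)
open import Data.List.Relation.Unary.All using () renaming (all? to allList?)
open import Data.Nat using (zero; suc)
import Data.Nat as ℕ
open import Data.Product using (_×_; _,_; ∃; proj₁; proj₂)
open import Data.Sum using (_⊎_)
open import Data.Vec using (Vec; []; _∷_; zipWith; replicate; here; there)
open import Data.Vec.Properties using (≡-dec; ∷-injective; zipWith-comm)
open import Function.Bundles using (_⇔_; mk⇔; Equivalence)
open import Relation.Binary.Definitions using (DecidableEquality)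
open import Relation.Binary.PropositionalEquality
  using (_≡_; _≢_; refl; sym; trans; cong; cong₂; subst; subst₂; module ≡-Reasoning)
open import Relation.Nullary using (Dec)
open import Relation.Nullary.Decidable using (_×-dec_; _⊎-dec_; _→-dec_; ¬?; map′; from-yes)
open import Relation.Unary using (Decidable)

open import Defs

Searchable : Set → Set₁
Searchable A = ∀ {P : A → Set} → Decidable P → Dec (∀ x → P x)

searchable-Bool : Searchable Bool
searchable-Bool P? = map′ (λ { (f , t) false → f ; (f , t) true → t }) (λ h → h false , h true) (P? false ×-dec P? true)

searchable-Vec : ∀ {A} → Searchable A → ∀ n → Searchable (Vec A n)
searchable-Vec sA zero P? = map′ (λ { p [] → p }) (λ h → h []) (P? [])
searchable-Vec sA (suc n) P? =
  map′ (λ { h (a ∷ v) → h a v }) (λ h a v → h (a ∷ v)) (sA λ a → searchable-Vec sA n λ v → P? (a ∷ v))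

searchable-× : ∀ {A B} → Searchable A → Searchable B → Searchable (A × B)
searchable-× sA sB P? = map′ (λ { h (a , b) → h a b }) (λ h a b → h (a , b)) (sA λ a → sB λ b → P? (a , b))

searchable-Pauli : Searchable Pauli
searchable-Pauli P? =
  map′ (λ { (i , x , y , z) I → i ; (i , x , y , z) X → x ; (i , x , y , z) Y → y ; (i , x , y , z) Z → z })
       (λ h → h I , h X , h Y , h Z)
       (P? I ×-dec P? X ×-dec P? Y ×-dec P? Z)

searchable-Pauli2 : Searchable Pauli2
searchable-Pauli2 = searchable-× searchable-Pauli searchable-Pauli

searchable-V4 : Searchable V4
searchable-V4 = searchable-Vec searchable-Bool 4

xor-cancelˡ : ∀ {n} (u v : Vec Bool n) → u ≡ zipWith _xor_ u v → v ≡ replicate n false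
xor-cancelˡ [] [] _ = refl
xor-cancelˡ (a ∷ u) (b ∷ v) eq = cong₂ _∷_ (bit a b (proj₁ (∷-injective eq))) (xor-cancelˡ u v (proj₂ (∷-injective eq)))
  where
  bit : ∀ a b → a ≡ a xor b → b ≡ false
  bit false b eq = sym eq
  bit true false _ = refl
  bit true true ()

xor-cancelʳ : ∀ {n} (u v : Vec Bool n) → v ≡ zipWith _xor_ u v → u ≡ replicate n false
xor-cancelʳ u v eq = xor-cancelˡ v u (trans eq (zipWith-comm xor-comm u v))

infix 4 _≟V_ _≟_

_≟V_ : DecidableEquality V4
_≟V_ = ≡-dec Bool._≟_

xBit zBit : Pauli → Bool
xBit I = false
xBit X = true
xBit Y = true
xBit Z = false
zBit I = false
zBit X = false
zBit Y = true
zBit Z = true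

fromBits : Bool → Bool → Pauli
fromBits false false = I
fromBits true  false = X
fromBits true  true  = Y
fromBits false true  = Z

fromBits-bits : ∀ p → fromBits (xBit p) (zBit p) ≡ p
fromBits-bits I = refl
fromBits-bits X = refl
fromBits-bits Y = refl
fromBits-bits Z = refl

toV4 : Pauli2 → V4
toV4 (p , r) = xBit p ∷ zBit p ∷ xBit r ∷ zBit r ∷ []

fromV4 : V4 → Pauli2
fromV4 (x₁ ∷ z₁ ∷ x₂ ∷ z₂ ∷ []) = fromBits x₁ z₁ , fromBits x₂ z₂

fromV4-toV4 : ∀ P → fromV4 (toV4 P) ≡ P
fromV4-toV4 (p , r) = cong₂ _,_ (fromBits-bits p) (fromBits-bits r)

toV4-injective : ∀ {P Q} → toV4 P ≡ toV4 Q → P ≡ Q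
toV4-injective {P} {Q} e = trans (sym (fromV4-toV4 P)) (trans (cong fromV4 e) (fromV4-toV4 Q))

_≟_ : DecidableEquality Pauli2
P ≟ Q = map′ toV4-injective (cong toV4) (toV4 P ≟V toV4 Q)

toV4-fromV4 : ∀ u → toV4 (fromV4 u) ≡ u
toV4-fromV4 = from-yes (searchable-V4 λ u → toV4 (fromV4 u) ≟V u)

toV4-· : ∀ P Q → toV4 (P · Q) ≡ toV4 P +4 toV4 Q
toV4-· = from-yes (searchable-Pauli2 λ P → searchable-Pauli2 λ Q → toV4 (P · Q) ≟V (toV4 P +4 toV4 Q))

ω-toV4 : ∀ P Q → ω (toV4 P) (toV4 Q) ≡ (anti₁ (proj₁ P) (proj₁ Q) xor anti₁ (proj₂ P) (proj₂ Q))
ω-toV4 = from-yes (searchable-Pauli2 λ P → searchable-Pauli2 λ Q →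
  ω (toV4 P) (toV4 Q) Bool.≟ (anti₁ (proj₁ P) (proj₁ Q) xor anti₁ (proj₂ P) (proj₂ Q)))

commute? : ∀ P Q → Dec (Commute P Q)
commute? P Q = _ Bool.≟ false

commute-· : ∀ P Q → Commute P Q → Commute P (P · Q) × Commute Q (P · Q)
commute-· = from-yes (searchable-Pauli2 λ P → searchable-Pauli2 λ Q →
  commute? P Q →-dec (commute? P (P · Q) ×-dec commute? Q (P · Q)))

pairwiseCommute-· : ∀ P Q {R} → R ≡ P · Q → Commute P Q → PairwiseCommute P Q R
pairwiseCommute-· P Q refl c = c , commute-· P Q c

·-self : ∀ P → P · P ≡ II
·-self = from-yes (searchable-Pauli2 λ P → P · P ≟ II)

·≡II⇒≡ : ∀ P Q → P · Q ≡ II → P ≡ Q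
·≡II⇒≡ = from-yes (searchable-Pauli2 λ P → searchable-Pauli2 λ Q → (P · Q ≟ II) →-dec (P ≟ Q))

isHyperplane? : ∀ G H → Dec (IsHyperplane G H)
isHyperplane? G H =
  any? (λ p → ¬? (p ∈? H)) ×-dec
  allList? (λ L → allList? (_∈? H) L ⊎-dec (countIn L H ℕ.≟ 1)) (lines G)

inS? : ∀ H → Dec (InS H)
inS? H = isHyperplane? CD7 H ×-dec 2F ∈? H ×-dec 3F ∈? H ×-dec 4F ∈? H ×-dec 5F ∈? H

labelA labelB : Subset 8 → Pauli2
labelA = labelOf labelingA
labelB = labelOf labelingB

hyperplane : V4 → Subset 8
hyperplane (x₁ ∷ z₁ ∷ x₂ ∷ z₂ ∷ []) = not z₁ ∷ not x₁ ∷ true ∷ true ∷ true ∷ true ∷ not z₂ ∷ not x₂ ∷ []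

labels-hyperplane : ∀ u → labelA (hyperplane u) ≡ fromV4 u × labelB (hyperplane u) ≡ fromV4 u
labels-hyperplane = from-yes (searchable-V4 λ u → labelA (hyperplane u) ≟ fromV4 u ×-dec labelB (hyperplane u) ≟ fromV4 u)

hyperplane-InS : ∀ u → u ≢ zero4 → InS (hyperplane u)
hyperplane-InS = from-yes (searchable-V4 λ u → ¬? (u ≟V zero4) →-dec inS? (hyperplane u))

hyperplane-+ : ∀ u v → ∁ (hyperplane u △ hyperplane v) ≡ hyperplane (u +4 v)
hyperplane-+ = from-yes (searchable-V4 λ u → searchable-V4 λ v →
  ≡-dec Bool._≟_ (∁ (hyperplane u △ hyperplane v)) (hyperplane (u +4 v)))

InS⇒hyperplane : ∀ {H} → InS H → ∃ λ u → hyperplane u ≡ H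
InS⇒hyperplane {a ∷ b ∷ _ ∷ _ ∷ _ ∷ _ ∷ g ∷ h ∷ []}
  (_ , there (there here) , there (there (there here)) , there (there (there (there here))) ,
   there (there (there (there (there here))))) =
  not b ∷ not a ∷ not h ∷ not g ∷ [] , eq
  where
  eq : hyperplane (not b ∷ not a ∷ not h ∷ not g ∷ []) ≡ a ∷ b ∷ true ∷ true ∷ true ∷ true ∷ g ∷ h ∷ []
  eq rewrite not-involutive a | not-involutive b | not-involutive g | not-involutive h = refl

labelVector : Subset 8 → V4
labelVector H = toV4 (labelA H)

labelVector-hyperplane : ∀ u → labelVector (hyperplane u) ≡ u
labelVector-hyperplane u = trans (cong toV4 (proj₁ (labels-hyperplane u))) (toV4-fromV4 u)

hyperplane-labelVector : ∀ {H} → InS H → hyperplane (labelVector H) ≡ H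
hyperplane-labelVector s with InS⇒hyperplane s
... | u , refl = cong hyperplane (labelVector-hyperplane u)

labelVector-nonzero : ∀ {H} → InS H → labelVector H ≢ zero4
labelVector-nonzero s@(((p , p∉H) , _) , _) e =
  p∉H (subst (p ∈_) (trans (cong hyperplane (sym e)) (hyperplane-labelVector s)) ∈⊤)

labelVector-injective : ∀ {H H′} → InS H → InS H′ → labelVector H ≡ labelVector H′ → H ≡ H′
labelVector-injective s s′ e = trans (sym (hyperplane-labelVector s)) (trans (cong hyperplane e) (hyperplane-labelVector s′))

labelA≡labelB : ∀ {H} → InS H → labelA H ≡ labelB H
labelA≡labelB s with InS⇒hyperplane s
... | u , refl = trans (proj₁ (labels-hyperplane u)) (sym (proj₂ (labels-hyperplane u)))

labelA-onto : ∀ P → P ≢ II → ∃ λ H → InS H × labelA H ≡ P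
labelA-onto P P≢II =
  hyperplane (toV4 P) , hyperplane-InS (toV4 P) (λ e → P≢II (toV4-injective e)) ,
  trans (proj₁ (labels-hyperplane (toV4 P))) (fromV4-toV4 P)

labelVector-onto : ∀ u → u ≢ zero4 → ∃ λ H → InS H × labelVector H ≡ u
labelVector-onto u u≢0 = hyperplane u , hyperplane-InS u u≢0 , labelVector-hyperplane u

∁△≡hyperplane : ∀ {H₁ H₂} → InS H₁ → InS H₂ → ∁ (H₁ △ H₂) ≡ hyperplane (labelVector H₁ +4 labelVector H₂)
∁△≡hyperplane {H₁} {H₂} s₁ s₂ = begin
  ∁ (H₁ △ H₂)
    ≡⟨ cong₂ (λ A B → ∁ (A △ B)) (sym (hyperplane-labelVector s₁)) (sym (hyperplane-labelVector s₂)) ⟩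
  ∁ (hyperplane (labelVector H₁) △ hyperplane (labelVector H₂))
    ≡⟨ hyperplane-+ (labelVector H₁) (labelVector H₂) ⟩
  hyperplane (labelVector H₁ +4 labelVector H₂) ∎
  where open ≡-Reasoning

module _ {H₁ H₂ H₃} (s₁ : InS H₁) (s₂ : InS H₂) (s₃ : InS H₃) where

  third⇔sum : H₃ ≡ ∁ (H₁ △ H₂) ⇔ labelVector H₃ ≡ labelVector H₁ +4 labelVector H₂
  third⇔sum = mk⇔
    (λ e → trans (cong labelVector (trans e (∁△≡hyperplane s₁ s₂))) (labelVector-hyperplane _))
    (λ e → trans (sym (hyperplane-labelVector s₃)) (trans (cong hyperplane e) (sym (∁△≡hyperplane s₁ s₂))))

  veldkampLine⇔ : IsVeldkampLine CD7 H₁ H₂ H₃ ⇔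
                  (labelVector H₁ ≢ labelVector H₂ × labelVector H₃ ≡ labelVector H₁ +4 labelVector H₂)
  veldkampLine⇔ = mk⇔
    (λ { (_ , _ , _ , H₁≢H₂ , _ , _ , e) →
           (λ e′ → H₁≢H₂ (labelVector-injective s₁ s₂ e′)) , Equivalence.to third⇔sum e })
    (λ { (u₁≢u₂ , e) →
           proj₁ s₁ , proj₁ s₂ , proj₁ s₃ , (λ e′ → u₁≢u₂ (cong labelVector e′)) ,
           (λ e′ → labelVector-nonzero s₂ (xor-cancelˡ _ _ (trans (cong labelVector e′) e))) ,
           (λ e′ → labelVector-nonzero s₁ (xor-cancelʳ _ _ (trans (cong labelVector e′) e))) ,
           Equivalence.from third⇔sum e })

  veldkamp-label : IsVeldkampLine CD7 H₁ H₂ H₃ → labelA H₃ ≡ labelA H₁ · labelA H₂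
  veldkamp-label v =
    toV4-injective (trans (proj₂ (Equivalence.to veldkampLine⇔ v)) (sym (toV4-· (labelA H₁) (labelA H₂))))

  w32Line⇔ : (IsVeldkampLine CD7 H₁ H₂ H₃ × PairwiseCommute (labelA H₁) (labelA H₂) (labelA H₃)) ⇔
             W32Line (labelVector H₁) (labelVector H₂) (labelVector H₃)
  w32Line⇔ = mk⇔ to from
    where
    to : IsVeldkampLine CD7 H₁ H₂ H₃ × PairwiseCommute (labelA H₁) (labelA H₂) (labelA H₃) →
         W32Line (labelVector H₁) (labelVector H₂) (labelVector H₃)
    to (v , c₁₂ , _) =
      labelVector-nonzero s₁ , labelVector-nonzero s₂ ,
      proj₁ (Equivalence.to veldkampLine⇔ v) , proj₂ (Equivalence.to veldkampLine⇔ v) ,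
      trans (ω-toV4 (labelA H₁) (labelA H₂)) c₁₂
    from : W32Line (labelVector H₁) (labelVector H₂) (labelVector H₃) →
           IsVeldkampLine CD7 H₁ H₂ H₃ × PairwiseCommute (labelA H₁) (labelA H₂) (labelA H₃)
    from (_ , _ , u₁≢u₂ , e , ω≡false) =
      v , pairwiseCommute-· (labelA H₁) (labelA H₂) (veldkamp-label v) (trans (sym (ω-toV4 (labelA H₁) (labelA H₂))) ω≡false)
      where
      v : IsVeldkampLine CD7 H₁ H₂ H₃
      v = Equivalence.from veldkampLine⇔ (u₁≢u₂ , e)

  labels-multiply-to-II : IsVeldkampLine CD7 H₁ H₂ H₃ → labelA H₁ · labelA H₂ · labelA H₃ ≡ II
  labels-multiply-to-II v = trans (cong (labelA H₁ · labelA H₂ ·_) (veldkamp-label v)) (·-self (labelA H₁ · labelA H₂))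

commVeldkampTriple-· : ∀ P Q → P ≢ II → Q ≢ II → P ≢ Q → Commute P Q → CommVeldkampTriple labelingA P Q (P · Q)
commVeldkampTriple-· P Q P≢II Q≢II P≢Q c =
  triple (labelA-onto P P≢II) (labelA-onto Q Q≢II) (labelA-onto (P · Q) (λ e → P≢Q (·≡II⇒≡ P Q e)))
  where
  triple : (∃ λ H → InS H × labelA H ≡ P) → (∃ λ H → InS H × labelA H ≡ Q) → (∃ λ H → InS H × labelA H ≡ P · Q) →
           CommVeldkampTriple labelingA P Q (P · Q)
  triple (H₁ , s₁ , l₁) (H₂ , s₂ , l₂) (H₃ , s₃ , l₃) =
    pairwiseCommute-· P Q refl c , H₁ , H₂ , H₃ , s₁ , s₂ , s₃ , proj₁ (Equivalence.from (w32Line⇔ s₁ s₂ s₃) line) , l₁ , l₂ , l₃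
    where
    line : W32Line (labelVector H₁) (labelVector H₂) (labelVector H₃)
    line = labelVector-nonzero s₁ , labelVector-nonzero s₂ ,
           (λ e → P≢Q (trans (sym l₁) (trans (toV4-injective e) l₂))) ,
           trans (cong toV4 (trans l₃ (cong₂ _·_ (sym l₁) (sym l₂)))) (toV4-· (labelA H₁) (labelA H₂)) ,
           trans (ω-toV4 (labelA H₁) (labelA H₂)) (subst₂ Commute (sym l₁) (sym l₂) c)

singleQubit? : Decidable SingleQubit
singleQubit? P = P ≟ (I , X) ⊎-dec P ≟ (I , Y) ⊎-dec P ≟ (I , Z) ⊎-dec P ≟ (X , I) ⊎-dec P ≟ (Y , I) ⊎-dec P ≟ (Z , I)

nine? : Decidable Nine
nine? P = ¬? (P ≟ II) ×-dec ¬? (singleQubit? P)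

Grid : Set
Grid = Fin 3 → Fin 3 → Pauli2

RowOrColumn : Grid → Pauli2 → Pauli2 → Pauli2 → Set
RowOrColumn g P Q R =
  (∃ λ i → (∃ λ j → g i j ≡ P) × (∃ λ j → g i j ≡ Q) × (∃ λ j → g i j ≡ R)) ⊎
  (∃ λ j → (∃ λ i → g i j ≡ P) × (∃ λ i → g i j ≡ Q) × (∃ λ i → g i j ≡ R))

rowOrColumn? : ∀ g P Q R → Dec (RowOrColumn g P Q R)
rowOrColumn? g P Q R =
  any? (λ i → any? (λ j → g i j ≟ P) ×-dec any? (λ j → g i j ≟ Q) ×-dec any? (λ j → g i j ≟ R)) ⊎-dec
  any? (λ j → any? (λ i → g i j ≟ P) ×-dec any? (λ i → g i j ≟ Q) ×-dec any? (λ i → g i j ≟ R))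

magicSquare : Grid
magicSquare 0F 0F = X , X
magicSquare 0F 1F = Y , Y
magicSquare 0F 2F = Z , Z
magicSquare 1F 0F = Y , Z
magicSquare 1F 1F = Z , X
magicSquare 1F 2F = X , Y
magicSquare 2F 0F = Z , Y
magicSquare 2F 1F = X , Z
magicSquare 2F 2F = Y , X

magicSquare-injective : ∀ i j k l → magicSquare i j ≡ magicSquare k l → i ≡ k × j ≡ l
magicSquare-injective = from-yes (all? λ i → all? λ j → all? λ k → all? λ l →
  (magicSquare i j ≟ magicSquare k l) →-dec (i Fin.≟ k ×-dec j Fin.≟ l))

magicSquare-nine : ∀ i j → Nine (magicSquare i j)
magicSquare-nine = from-yes (all? λ i → all? λ j → nine? (magicSquare i j))

magicSquare-onto : ∀ P → Nine P → ∃ λ i → ∃ λ j → magicSquare i j ≡ P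
magicSquare-onto = from-yes (searchable-Pauli2 λ P → nine? P →-dec any? λ i → any? λ j → magicSquare i j ≟ P)

-- No commutation hypothesis is needed: P · Q is again among the nine only if
-- P and Q differ in both tensor factors, and then they commute.
nine-line-rowOrColumn : ∀ P Q → Nine P → Nine Q → Nine (P · Q) → RowOrColumn magicSquare P Q (P · Q)
nine-line-rowOrColumn = from-yes (searchable-Pauli2 λ P → searchable-Pauli2 λ Q →
  nine? P →-dec nine? Q →-dec nine? (P · Q) →-dec rowOrColumn? magicSquare P Q (P · Q))

magicSquare-row : ∀ i → CommVeldkampTriple labelingA (magicSquare i 0F) (magicSquare i 1F) (magicSquare i 2F)
magicSquare-row 0F = commVeldkampTriple-· (X , X) (Y , Y) (λ ()) (λ ()) (λ ()) refl
magicSquare-row 1F = commVeldkampTriple-· (Y , Z) (Z , X) (λ ()) (λ ()) (λ ()) refl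
magicSquare-row 2F = commVeldkampTriple-· (Z , Y) (X , Z) (λ ()) (λ ()) (λ ()) refl

magicSquare-column : ∀ j → CommVeldkampTriple labelingA (magicSquare 0F j) (magicSquare 1F j) (magicSquare 2F j)
magicSquare-column 0F = commVeldkampTriple-· (X , X) (Y , Z) (λ ()) (λ ()) (λ ()) refl
magicSquare-column 1F = commVeldkampTriple-· (Y , Y) (Z , X) (λ ()) (λ ()) (λ ()) refl
magicSquare-column 2F = commVeldkampTriple-· (Z , Z) (X , Y) (λ ()) (λ ()) (λ ()) refl

commVeldkampTriple-rowOrColumn : ∀ P Q R → Nine P → Nine Q → Nine R →
  CommVeldkampTriple labelingA P Q R → RowOrColumn magicSquare P Q R
commVeldkampTriple-rowOrColumn P Q R nP nQ nR (_ , H₁ , H₂ , H₃ , s₁ , s₂ , s₃ , v , l₁ , l₂ , l₃) =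
  subst (RowOrColumn magicSquare P Q) (sym R≡P·Q) (nine-line-rowOrColumn P Q nP nQ (subst Nine R≡P·Q nR))
  where
  R≡P·Q : R ≡ P · Q
  R≡P·Q = trans (sym l₃) (trans (veldkamp-label s₁ s₂ s₃ v) (cong₂ _·_ l₁ l₂))

mainTheorem9 :
    (∀ H → InS H → labelOf labelingA H ≡ labelOf labelingB H) ×
    (∀ H → InS H → labelOf labelingA H ≢ II) ×
    (∀ H H′ → InS H → InS H′ → labelOf labelingA H ≡ labelOf labelingA H′ → H ≡ H′) ×
    (∀ P → P ≢ II → ∃ λ H → InS H × labelOf labelingA H ≡ P) ×
    (∀ H₁ H₂ H₃ → InS H₁ → InS H₂ → InS H₃ → IsVeldkampLine CD7 H₁ H₂ H₃ →
      labelOf labelingA H₁ · labelOf labelingA H₂ · labelOf labelingA H₃ ≡ II) ×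
    (∃ λ (f : Subset 8 → V4) →
      (∀ H → InS H → W32Point (f H)) ×
      (∀ H H′ → InS H → InS H′ → f H ≡ f H′ → H ≡ H′) ×
      (∀ u → W32Point u → ∃ λ H → InS H × f H ≡ u) ×
      (∀ H₁ H₂ H₃ → InS H₁ → InS H₂ → InS H₃ →
        ((IsVeldkampLine CD7 H₁ H₂ H₃ ×
          PairwiseCommute (labelOf labelingA H₁) (labelOf labelingA H₂) (labelOf labelingA H₃))
         ⇔ W32Line (f H₁) (f H₂) (f H₃)))) ×
    (∃ λ (g : Fin 3 → Fin 3 → Pauli2) →
      (∀ i j k l → g i j ≡ g k l → (i ≡ k × j ≡ l)) ×
      (∀ i j → Nine (g i j)) ×
      (∀ P → Nine P → ∃ λ i → ∃ λ j → g i j ≡ P) ×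
      (∀ i → CommVeldkampTriple labelingA (g i 0F) (g i 1F) (g i 2F)) ×
      (∀ j → CommVeldkampTriple labelingA (g 0F j) (g 1F j) (g 2F j)) ×
      (∀ P Q R → Nine P → Nine Q → Nine R → CommVeldkampTriple labelingA P Q R →
        (∃ λ i → (∃ λ j → g i j ≡ P) × (∃ λ j → g i j ≡ Q) × (∃ λ j → g i j ≡ R)) ⊎
        (∃ λ j → (∃ λ i → g i j ≡ P) × (∃ λ i → g i j ≡ Q) × (∃ λ i → g i j ≡ R))))
mainTheorem9 =
  (λ _ → labelA≡labelB) ,
  (λ _ s e → labelVector-nonzero s (cong toV4 e)) ,
  (λ _ _ s s′ e → labelVector-injective s s′ (cong toV4 e)) ,
  labelA-onto ,
  (λ _ _ _ → labels-multiply-to-II) ,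
  (labelVector , (λ _ → labelVector-nonzero) , (λ _ _ → labelVector-injective) , labelVector-onto ,
   (λ _ _ _ → w32Line⇔)) ,
  (magicSquare , magicSquare-injective , magicSquare-nine , magicSquare-onto ,
   magicSquare-row , magicSquare-column , commVeldkampTriple-rowOrColumn)
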